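{- For every integer $n\ge 4$, the derangement graph $\Gamma_n$ is vertex pancyclic: every vertex of $\Gamma_n$ lies on a cycle of each length $\ell$ with $3\le \ell\le n!$. In particular, $\Gamma_n$ is pancyclic.
   Context: Let $S_n$ be the symmetric group on $[n]=\{1,\ldots,n\}$ and $D_n$ the set of derangements (permutations without fixed points) in $S_n$. The derangement graph $\Gamma_n$ is the Cayley graph $\Gamma(S_n,D_n)$: vertices are the permutations in $S_n$, and $g,h$ are adjacent if and only if $g(i)\ne h(i)$ for all $i\in[n]$. A graph on $N\ge3$ vertices is pancyclic if it contains a cycle of every length from $3$ to $N$, and vertex pancyclic if every vertex lies on a cycle of every length from $3$ to $N$. -}

module Defs where

open import Data.Nat using (ℕ; zero; suc; _≤_; _!)
open import Data.Fin using (Fin; zero; suc; toℕ; fromℕ<)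
open import Data.Fin.Permutation using (Permutation′; _⟨$⟩ʳ_)
open import Data.Nat.DivMod using (_%_; m%n<n)
open import Data.Product using (Σ; _×_)
open import Relation.Binary.PropositionalEquality using (_≡_)
open import Relation.Nullary using (¬_)

-- Vertices of Γ_n: permutations of [n] = Fin n (stdlib bijections Fin n ↔ Fin n).
-- Two permutations are the same vertex iff they agree pointwise.
SamePerm : {n : ℕ} → Permutation′ n → Permutation′ n → Set
SamePerm g h = ∀ i → g ⟨$⟩ʳ i ≡ h ⟨$⟩ʳ i

Adjacent : {n : ℕ} → Permutation′ n → Permutation′ n → Set
Adjacent g h = ∀ i → ¬ (g ⟨$⟩ʳ i ≡ h ⟨$⟩ʳ i)

next : {k : ℕ} → Fin (suc k) → Fin (suc k)
next {k} i = fromℕ< (m%n<n (suc (toℕ i)) (suc k))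

-- A cycle of length ℓ = suc k in Γ_n through vertex v: a sequence
-- c 0 = v, c 1, …, c k of pairwise distinct vertices with c i ~ c (i+1 mod ℓ).
-- (For ℓ ≥ 3 this is exactly a cycle subgraph of length ℓ containing v.)
CycleThrough : (n : ℕ) → Permutation′ n → ℕ → Set
CycleThrough n v zero = Data.Empty.⊥ where import Data.Empty
CycleThrough n v (suc k) =
  Σ (Fin (suc k) → Permutation′ n) λ c →
    SamePerm (c zero) v
    × (∀ i → Adjacent (c i) (c (next i)))
    × (∀ i j → SamePerm (c i) (c j) → i ≡ j)

VertexPancyclic : ℕ → Set
VertexPancyclic n = (v : Permutation′ n) (ℓ : ℕ) → 3 ≤ ℓ → ℓ ≤ n ! → CycleThrough n v ℓ

module Submission where

-- Write n = k + 1 and let x ∈ S_k act on [n] fixing 0. Composing x with the rotation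
-- i ↦ i + A (mod n) gives n·k! = n! distinct vertices; those with the same x form an
-- n-clique, the "column" of x. If x and y agree at some point, the differences x(i) − y(i)
-- (mod n) repeat the value 0, so some residue c is missed, and then (x, A) ~ (y, A + c)
-- for every A: the columns of x and y are joined by a perfect matching. Listing S_k so
-- that consecutive permutations agree somewhere (inserting the image of 0 in snake order)
-- and walking down a column, with one excursion into the later columns, yields for every
-- 2 ≤ L ≤ n! a path of L vertices from (x, 0) to (x, 1); the clique edge closes it to a
-- cycle. As Γ_n is a Cayley graph, translating the cycle makes it pass through any vertex.

open import Defs
open import Data.Bool using (Bool; true; false; not)
open import Data.Empty using (⊥-elim)
open import Data.Fin using (Fin; zero; suc; toℕ; fromℕ; fromℕ<; inject₁; punchIn; punchOut)
import Data.Fin.Properties as Finₚ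
open import Data.Fin.Permutation as Perm
  using (Permutation′; _⟨$⟩ʳ_; _⟨$⟩ˡ_; _∘ₚ_; lift₀; permutation)
open import Data.List using (List; []; _∷_; _++_; _∷ʳ_; map; length; applyUpTo)
import Data.List.Properties as Listₚ
open import Data.List.Relation.Unary.All as All using (All; []; _∷_)
import Data.List.Relation.Unary.All.Properties as Allₚ
open import Data.List.Relation.Unary.AllPairs using (AllPairs; []; _∷_)
import Data.List.Relation.Unary.AllPairs as AllPairs
import Data.List.Relation.Unary.AllPairs.Properties as AllPairsₚ
open import Data.List.Relation.Unary.Any using (Any; here; there)
open import Data.List.Relation.Unary.Unique.Propositional using (Unique)
import Data.List.Relation.Unary.Unique.Propositional.Properties as Uniqueₚ
open import Data.List.Relation.Unary.Linked using (Linked; []; [-]; _∷_)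
import Data.List.Relation.Unary.Linked as Linked
open import Data.Nat using (ℕ; zero; suc; _+_; _*_; _∸_; _≤_; _<_; z≤n; s≤s; s≤s⁻¹; _!)
open import Data.Nat.Properties
open import Data.Nat.DivMod
  using (_%_; m%n<n; m%n%n≡m%n; %-distribˡ-+; [m+kn]%n≡m%n; m<n⇒m%n≡m; n%n≡0)
open import Data.Product using (Σ; ∃; _×_; _,_; proj₁; proj₂)
open import Function using (_∘′_; Injection)
open import Function.Properties.Inverse using (↔⇒↣)
open import Relation.Binary.PropositionalEquality
open import Relation.Nullary using (¬_; Dec; yes; no)

private variable
  A B : Set

data Path (R : A → A → Set) : A → A → List A → Set where
  [-] : ∀ {a} → Path R a a (a ∷ [])
  _∷_ : ∀ {a b c xs} → R a b → Path R b c xs → Path R a c (a ∷ xs)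

module _ {R : A → A → Set} where

  infixr 5 _++⟨_⟩_
  _++⟨_⟩_ : ∀ {a b c d xs ys} → Path R a b xs → R b c → Path R c d ys → Path R a d (xs ++ ys)
  [-]     ++⟨ r ⟩ q = r ∷ q
  (s ∷ p) ++⟨ r ⟩ q = s ∷ (p ++⟨ r ⟩ q)

  Path-map : ∀ {S : B → B → Set} (f : A → B) → (∀ {u v} → R u v → S (f u) (f v)) →
             ∀ {a b xs} → Path R a b xs → Path S (f a) (f b) (map f xs)
  Path-map f f-hom [-]     = [-]
  Path-map f f-hom (r ∷ p) = f-hom r ∷ Path-map f f-hom p

  Path⇒Linked : ∀ {a b xs} → Path R a b xs → Linked R xs
  Path⇒Linked [-]             = [-]
  Path⇒Linked (r ∷ [-])       = r ∷ [-]
  Path⇒Linked (r ∷ p@(_ ∷ _)) = r ∷ Path⇒Linked p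

lastOf : A → List A → A
lastOf a []       = a
lastOf _ (b ∷ xs) = lastOf b xs

lastOf-∷ʳ : ∀ (a : A) xs b → lastOf a (xs ∷ʳ b) ≡ b
lastOf-∷ʳ a []       b = refl
lastOf-∷ʳ a (x ∷ xs) b = lastOf-∷ʳ x xs b

clique⇒Path : ∀ {R D : A → A → Set} → (∀ {u v} → D u v → R u v) →
              ∀ {a xs} → AllPairs D (a ∷ xs) → Path R a (lastOf a xs) (a ∷ xs)
clique⇒Path edge {xs = []}    _                    = [-]
clique⇒Path edge {xs = _ ∷ _} ((dab ∷ _) ∷ pairs) = edge dab ∷ clique⇒Path edge pairs

module _ {R : A → A → Set} where

  AllPairs-++⁻ : ∀ xs {ys} → AllPairs R (xs ++ ys) → AllPairs R xs × AllPairs R ys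
  AllPairs-++⁻ []       rs       = [] , rs
  AllPairs-++⁻ (x ∷ xs) (r ∷ rs) =
    let rxs , rys = AllPairs-++⁻ xs rs in (Allₚ.++⁻ˡ xs r ∷ rxs) , rys

  AllPairs-middle⁺ : ∀ xs {ys zs} → AllPairs R (xs ++ zs) → AllPairs R ys →
                     All (λ x → All (R x) ys) xs → All (λ y → All (R y) zs) ys →
                     AllPairs R (xs ++ ys ++ zs)
  AllPairs-middle⁺ []       rxzs      rys _            ryzs = AllPairsₚ.++⁺ rys rxzs ryzs
  AllPairs-middle⁺ (x ∷ xs) (rx ∷ rs) rys (rxy ∷ rxys) ryzs =
    Allₚ.++⁺ (Allₚ.++⁻ˡ xs rx) (Allₚ.++⁺ rxy (Allₚ.++⁻ʳ xs rx)) ∷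
    AllPairs-middle⁺ xs rs rys rxys ryzs

length-middle : ∀ (xs ys zs : List A) → length (xs ++ ys ++ zs) ≡ length (xs ++ zs) + length ys
length-middle xs ys zs = begin
  length (xs ++ ys ++ zs)              ≡⟨ Listₚ.length-++ xs ⟩
  length xs + length (ys ++ zs)        ≡⟨ cong (length xs +_) (Listₚ.length-++ ys) ⟩
  length xs + (length ys + length zs)  ≡⟨ cong (length xs +_) (+-comm (length ys) (length zs)) ⟩
  length xs + (length zs + length ys)  ≡⟨ +-assoc (length xs) (length zs) (length ys) ⟨
  length xs + length zs + length ys    ≡⟨ cong (_+ length ys) (Listₚ.length-++ xs) ⟨
  length (xs ++ zs) + length ys        ∎
  where open ≡-Reasoning

nth : A → List A → ℕ → A
nth d []       _       = d
nth _ (x ∷ xs) zero    = x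
nth d (x ∷ xs) (suc i) = nth d xs i

module _ {R : A → A → Set} (d : A) where

  Path-nth-head : ∀ {a b xs} → Path R a b xs → nth d xs 0 ≡ a
  Path-nth-head [-]     = refl
  Path-nth-head (_ ∷ _) = refl

  Path-nth-step : ∀ {a b xs} → Path R a b xs → ∀ i → suc i < length xs →
                  R (nth d xs i) (nth d xs (suc i))
  Path-nth-step [-]     zero    (s≤s ())
  Path-nth-step (r ∷ p) zero    _        = subst (R _) (sym (Path-nth-head p)) r
  Path-nth-step (r ∷ p) (suc i) (s≤s i<) = Path-nth-step p i i<

  Path-nth-last : ∀ {a b xs} → Path R a b xs → ∀ m → length xs ≡ suc m → nth d xs m ≡ b
  Path-nth-last [-]         zero    _   = refl
  Path-nth-last (_ ∷ [-])   zero    ()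
  Path-nth-last (_ ∷ _ ∷ _) zero    ()
  Path-nth-last (_ ∷ p)     (suc m) len = Path-nth-last p m (suc-injective len)

All-nth : ∀ {P : A → Set} (d : A) {xs} → All P xs → ∀ {i} → i < length xs → P (nth d xs i)
All-nth d (p ∷ _)  {zero}  _        = p
All-nth d (_ ∷ ps) {suc i} (s≤s i<) = All-nth d ps i<

AllPairs-nth-injective : ∀ {S : A → A → Set} → (∀ {u v} → S u v → S v u) → (d : A) →
                         ∀ {xs} → AllPairs (λ u v → ¬ S u v) xs → ∀ {i j} →
                         i < length xs → j < length xs → S (nth d xs i) (nth d xs j) → i ≡ j
AllPairs-nth-injective S-sym d (_  ∷ _)  {zero}  {zero}  _        _        _ = refl
AllPairs-nth-injective S-sym d (¬s ∷ _)  {zero}  {suc j} _        (s≤s j<) s =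
  ⊥-elim (All-nth d ¬s j< s)
AllPairs-nth-injective S-sym d (¬s ∷ _)  {suc i} {zero}  (s≤s i<) _        s =
  ⊥-elim (All-nth d ¬s i< (S-sym s))
AllPairs-nth-injective S-sym d (_  ∷ ps) {suc i} {suc j} (s≤s i<) (s≤s j<) s =
  cong suc (AllPairs-nth-injective S-sym d ps i< j< s)

infix 4 _≉_
_≉_ : ∀ {m} → Permutation′ m → Permutation′ m → Set
g ≉ h = ¬ SamePerm g h

toℕ-next : ∀ {m} (i : Fin (suc m)) → toℕ (next i) ≡ suc (toℕ i) % suc m
toℕ-next {m} i = Finₚ.toℕ-fromℕ< (m%n<n (suc (toℕ i)) (suc m))

closedPath⇒CycleThrough : ∀ {n} {v u : Permutation′ n} {ws m} →
                          Path Adjacent v u ws → Adjacent u v → AllPairs _≉_ ws →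
                          length ws ≡ suc m → CycleThrough n v (suc m)
closedPath⇒CycleThrough {v = v} {ws = ws} {m} path closing distinct len =
  c , c-head , c-adjacent , c-injective
  where
  c : Fin (suc m) → Permutation′ _
  c i = nth v ws (toℕ i)

  c-head : SamePerm (c zero) v
  c-head i = cong (_⟨$⟩ʳ i) (Path-nth-head v path)

  bounded : ∀ {i} → i < suc m → i < length ws
  bounded {i} = subst (i <_) (sym len)

  c-adjacent : ∀ i → Adjacent (c i) (c (next i))
  c-adjacent i with suc (toℕ i) ≤? m
  ... | yes i<m = subst (λ j → Adjacent (c i) (nth v ws j))
                        (sym (trans (toℕ-next i) (m<n⇒m%n≡m (s≤s i<m))))
                        (Path-nth-step v path (toℕ i) (bounded (s≤s i<m)))
  ... | no  i≮m = subst₂ Adjacent (sym (trans (cong (nth v ws) i≡m) (Path-nth-last v path m len)))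
                                  (sym (trans (cong (nth v ws) next≡0) (Path-nth-head v path)))
                                  closing
    where
    i≡m : toℕ i ≡ m
    i≡m = ≤-antisym (s≤s⁻¹ (Finₚ.toℕ<n i)) (s≤s⁻¹ (≰⇒> i≮m))
    next≡0 : toℕ (next i) ≡ 0
    next≡0 = trans (toℕ-next i) (trans (cong (λ j → suc j % suc m) i≡m) (n%n≡0 (suc m)))

  c-injective : ∀ i j → SamePerm (c i) (c j) → i ≡ j
  c-injective i j s = Finₚ.toℕ-injective (AllPairs-nth-injective (λ s x → sym (s x)) v distinct
                                            (bounded (Finₚ.toℕ<n i)) (bounded (Finₚ.toℕ<n j)) s)

CycleThrough-transport : ∀ {n w v ℓ} → CycleThrough n w ℓ → CycleThrough n v ℓ
CycleThrough-transport {n} {w} {v} {suc m} (c , c-head , c-adjacent , c-injective) =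
  (λ i → translate (c i)) , head ,
  (λ i x e → c-adjacent i x (cancel (c i) (c (next i)) e)) ,
  (λ i j s → c-injective i j (λ x → cancel (c i) (c j) (s x)))
  where
  -- g ↦ v ∘ w⁻¹ ∘ g, an automorphism of Γ_n sending w to v (_∘ₚ_ composes left to right).
  translate : Permutation′ n → Permutation′ n
  translate g = g ∘ₚ Perm.flip w ∘ₚ v

  cancel : ∀ g h {x} → translate g ⟨$⟩ʳ x ≡ translate h ⟨$⟩ʳ x → g ⟨$⟩ʳ x ≡ h ⟨$⟩ʳ x
  cancel _ _ = Injection.injective (↔⇒↣ (Perm.flip w)) ∘′ Injection.injective (↔⇒↣ v)

  head : SamePerm (translate (c zero)) v
  head x = trans (cong (λ y → v ⟨$⟩ʳ (w ⟨$⟩ˡ y)) (c-head x)) (cong (v ⟨$⟩ʳ_) (Perm.inverseˡ w))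

-- Listing S_k so that consecutive permutations agree somewhere

Share : ∀ {m} → Permutation′ m → Permutation′ m → Set
Share x y = ∃ λ i → x ⟨$⟩ʳ i ≡ y ⟨$⟩ʳ i

data Neighbours {k : ℕ} : Fin (suc k) → Fin (suc k) → Set where
  up   : ∀ w → Neighbours (inject₁ w) (suc w)
  down : ∀ w → Neighbours (suc w) (inject₁ w)

ascending : (k : ℕ) → List (Fin (suc k))
ascending zero    = zero ∷ []
ascending (suc k) = zero ∷ map suc (ascending k)

descending : (k : ℕ) → List (Fin (suc k))
descending zero    = zero ∷ []
descending (suc k) = fromℕ (suc k) ∷ map inject₁ (descending k)

ascending-path : ∀ k → Path Neighbours zero (fromℕ k) (ascending k)
ascending-path zero    = [-]
ascending-path (suc k) = up zero ∷ Path-map suc suc-neighbours (ascending-path k)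
  where
  suc-neighbours : ∀ {a b} → Neighbours {k} a b → Neighbours (suc a) (suc b)
  suc-neighbours (up w)   = up (suc w)
  suc-neighbours (down w) = down (suc w)

descending-path : ∀ k → Path Neighbours (fromℕ k) zero (descending k)
descending-path zero    = [-]
descending-path (suc k) = down (fromℕ k) ∷ Path-map inject₁ inject₁-neighbours (descending-path k)
  where
  inject₁-neighbours : ∀ {a b} → Neighbours {k} a b → Neighbours (inject₁ a) (inject₁ b)
  inject₁-neighbours (up w)   = up (inject₁ w)
  inject₁-neighbours (down w) = down (inject₁ w)

ascending-unique : ∀ k → Unique (ascending k)
ascending-unique zero    = [] ∷ []
ascending-unique (suc k) =
  Allₚ.map⁺ (All.universal (λ _ ()) (ascending k)) ∷
  Uniqueₚ.map⁺ Finₚ.suc-injective (ascending-unique k)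

descending-unique : ∀ k → Unique (descending k)
descending-unique zero    = [] ∷ []
descending-unique (suc k) =
  Allₚ.map⁺ (All.universal (λ _ → Finₚ.fromℕ≢inject₁) (descending k)) ∷
  Uniqueₚ.map⁺ Finₚ.inject₁-injective (descending-unique k)

length-ascending : ∀ k → length (ascending k) ≡ suc k
length-ascending zero    = refl
length-ascending (suc k) =
  cong suc (trans (Listₚ.length-map suc (ascending k)) (length-ascending k))

length-descending : ∀ k → length (descending k) ≡ suc k
length-descending zero    = refl
length-descending (suc k) =
  cong suc (trans (Listₚ.length-map inject₁ (descending k)) (length-descending k))

run : Bool → (k : ℕ) → List (Fin (suc k))
run true  = ascending
run false = descending

runStart runEnd : Bool → (k : ℕ) → Fin (suc k)
runStart true  k = zero
runStart false k = fromℕ k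
runEnd   true  k = fromℕ k
runEnd   false k = zero

run-path : ∀ d k → Path Neighbours (runStart d k) (runEnd d k) (run d k)
run-path true  = ascending-path
run-path false = descending-path

run-unique : ∀ d k → Unique (run d k)
run-unique true  = ascending-unique
run-unique false = descending-unique

length-run : ∀ d k → length (run d k) ≡ suc k
length-run true  = length-ascending
length-run false = length-descending

runEnd≡runStart-not : ∀ d k → runEnd d k ≡ runStart (not d) k
runEnd≡runStart-not true  k = refl
runEnd≡runStart-not false k = refl

insert₀ : ∀ {k} → Fin (suc k) → Permutation′ k → Permutation′ (suc k)
insert₀ = Perm.insert zero

insert₀-injective : ∀ {k} {v v′ : Fin (suc k)} {π π′} →
                    SamePerm (insert₀ v π) (insert₀ v′ π′) → v ≡ v′ × SamePerm π π′
insert₀-injective {v = v} {v′} {π} {π′} s = s zero , λ i → Finₚ.punchIn-injective v _ _ (begin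
  punchIn v (π ⟨$⟩ʳ i)      ≡⟨ Perm.insert-punchIn zero v π i ⟨
  insert₀ v π ⟨$⟩ʳ suc i     ≡⟨ s (suc i) ⟩
  insert₀ v′ π′ ⟨$⟩ʳ suc i   ≡⟨ Perm.insert-punchIn zero v′ π′ i ⟩
  punchIn v′ (π′ ⟨$⟩ʳ i)    ≡⟨ cong (λ u → punchIn u (π′ ⟨$⟩ʳ i)) (s zero) ⟨
  punchIn v (π′ ⟨$⟩ʳ i)     ∎)
  where open ≡-Reasoning

punchIn-inject₁≡punchIn-suc : ∀ {k} (w y : Fin k) → y ≢ w → punchIn (inject₁ w) y ≡ punchIn (suc w) y
punchIn-inject₁≡punchIn-suc zero    zero    y≢w = ⊥-elim (y≢w refl)
punchIn-inject₁≡punchIn-suc zero    (suc y) _   = refl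
punchIn-inject₁≡punchIn-suc (suc w) zero    _   = refl
punchIn-inject₁≡punchIn-suc (suc w) (suc y) y≢w =
  cong suc (punchIn-inject₁≡punchIn-suc w y (y≢w ∘′ cong suc))

neighbours⇒Share : ∀ {k} (π : Permutation′ (suc (suc k))) {a b} → Neighbours a b →
                   Share (insert₀ a π) (insert₀ b π)
neighbours⇒Share π (up w)   = suc i , (begin
  insert₀ (inject₁ w) π ⟨$⟩ʳ suc i  ≡⟨ Perm.insert-punchIn zero (inject₁ w) π i ⟩
  punchIn (inject₁ w) (π ⟨$⟩ʳ i)   ≡⟨ cong (punchIn (inject₁ w)) πi≡y ⟩
  punchIn (inject₁ w) y            ≡⟨ punchIn-inject₁≡punchIn-suc w y (Finₚ.punchInᵢ≢i w zero) ⟩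
  punchIn (suc w) y                ≡⟨ cong (punchIn (suc w)) πi≡y ⟨
  punchIn (suc w) (π ⟨$⟩ʳ i)       ≡⟨ Perm.insert-punchIn zero (suc w) π i ⟨
  insert₀ (suc w) π ⟨$⟩ʳ suc i      ∎)
  where
  open ≡-Reasoning
  -- any value other than w
  y = punchIn w zero
  i = π ⟨$⟩ˡ y
  πi≡y : π ⟨$⟩ʳ i ≡ y
  πi≡y = Perm.inverseʳ π
neighbours⇒Share π (down w) = let i , e = neighbours⇒Share π (up w) in i , sym e

block : ∀ {k} → Bool → Permutation′ k → List (Permutation′ (suc k))
block {k} d π = map (λ v → insert₀ v π) (run d k)

snake : ∀ {k} → Bool → List (Permutation′ k) → List (Permutation′ (suc k))
snake d []           = []
snake d (π ∷ [])     = block d π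
snake d (π ∷ ρ ∷ πs) = block d π ++ snake (not d) (ρ ∷ πs)

module _ {k : ℕ} where

  block-path : ∀ d (π : Permutation′ (suc (suc k))) →
               Path Share (insert₀ (runStart d _) π) (insert₀ (runEnd d _) π) (block d π)
  block-path d π = Path-map (λ v → insert₀ v π) (neighbours⇒Share π) (run-path d _)

  snake-path : ∀ d (π : Permutation′ (suc (suc k))) πs →
               ∃ λ σ → Path Share (insert₀ (runStart d _) π) σ (snake d (π ∷ πs))
  snake-path d π []       = _ , block-path d π
  snake-path d π (ρ ∷ πs) =
    _ , block-path d π ++⟨ zero , runEnd≡runStart-not d _ ⟩ proj₂ (snake-path (not d) ρ πs)

  snake-linked : ∀ d (πs : List (Permutation′ (suc (suc k)))) → Linked Share (snake d πs)
  snake-linked d []       = []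
  snake-linked d (π ∷ πs) = Path⇒Linked (proj₂ (snake-path d π πs))

  length-block : ∀ d (π : Permutation′ k) → length (block d π) ≡ suc k
  length-block d π = trans (Listₚ.length-map _ (run d k)) (length-run d k)

  length-snake : ∀ d (πs : List (Permutation′ k)) → length (snake d πs) ≡ suc k * length πs
  length-snake d []           = sym (*-zeroʳ (suc k))
  length-snake d (π ∷ [])     = trans (length-block d π) (sym (*-identityʳ (suc k)))
  length-snake d (π ∷ ρ ∷ πs) = begin
    length (block d π ++ snake (not d) (ρ ∷ πs))          ≡⟨ Listₚ.length-++ (block d π) ⟩
    length (block d π) + length (snake (not d) (ρ ∷ πs))  ≡⟨ cong₂ _+_ (length-block d π)
                                                                       (length-snake (not d) (ρ ∷ πs)) ⟩
    suc k + suc k * length (ρ ∷ πs)                       ≡⟨ *-suc (suc k) (length (ρ ∷ πs)) ⟨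
    suc k * length (π ∷ ρ ∷ πs)                           ∎
    where open ≡-Reasoning

  block-unique : ∀ d (π : Permutation′ k) → AllPairs _≉_ (block d π)
  block-unique d π = AllPairsₚ.map⁺
    (AllPairs.map (λ v≢v′ s → v≢v′ (proj₁ (insert₀-injective s))) (run-unique d k))

  block-apart : ∀ d {π ρ : Permutation′ k} v → π ≉ ρ → All (insert₀ v π ≉_) (block d ρ)
  block-apart d v π≉ρ =
    Allₚ.map⁺ (All.universal (λ _ s → π≉ρ (proj₂ (insert₀-injective s))) (run d k))

  snake-apart : ∀ d {π : Permutation′ k} v πs → All (π ≉_) πs → All (insert₀ v π ≉_) (snake d πs)
  snake-apart d v []           []              = []
  snake-apart d v (ρ ∷ [])     (π≉ρ ∷ [])      = block-apart d v π≉ρ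
  snake-apart d v (ρ ∷ σ ∷ πs) (π≉ρ ∷ π≉σπs) =
    Allₚ.++⁺ (block-apart d v π≉ρ) (snake-apart (not d) v (σ ∷ πs) π≉σπs)

  snake-unique : ∀ d (πs : List (Permutation′ k)) → AllPairs _≉_ πs → AllPairs _≉_ (snake d πs)
  snake-unique d []           _                    = []
  snake-unique d (π ∷ [])     _                    = block-unique d π
  snake-unique d (π ∷ ρ ∷ πs) (π≉ρπs ∷ ρπs-unique) =
    AllPairsₚ.++⁺ (block-unique d π) (snake-unique (not d) (ρ ∷ πs) ρπs-unique)
      (Allₚ.map⁺ (All.universal (λ v → snake-apart (not d) v (ρ ∷ πs) π≉ρπs) (run d k)))

permutations : (k : ℕ) → List (Permutation′ k)
permutations zero    = Perm.id ∷ []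
permutations (suc k) = snake true (permutations k)

length-permutations : ∀ k → length (permutations k) ≡ k !
length-permutations zero    = refl
length-permutations (suc k) =
  trans (length-snake true (permutations k)) (cong (suc k *_) (length-permutations k))

permutations-unique : ∀ k → AllPairs _≉_ (permutations k)
permutations-unique zero    = [] ∷ []
permutations-unique (suc k) = snake-unique true (permutations k) (permutations-unique k)

permutations-linked : ∀ k → Linked Share (permutations (3 + k))
permutations-linked k = snake-linked true (permutations (2 + k))

-- Columns and the matchings between them

collision⇒unhit : ∀ {m} (Q : Fin (suc m) → Fin (suc m) → Set) → (∀ c i → Dec (Q c i)) →
                  (∀ c c′ i → Q c i → Q c′ i → c ≡ c′) →
                  ∀ {c₀ i₀ i₁} → i₀ ≢ i₁ → Q c₀ i₀ → Q c₀ i₁ → ∃ λ c → ∀ i → ¬ Q c i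
collision⇒unhit {m} Q Q? functional {c₀} {i₀} {i₁} i₀≢i₁ q₀ q₁
  with Finₚ.all? (λ c → Finₚ.any? (Q? c))
... | no ¬all-hit =
  let c , unhit = Finₚ.¬∀⟶∃¬ _ _ (λ c → Finₚ.any? (Q? c)) ¬all-hit in c , λ i q → unhit (i , q)
... | yes all-hit = ⊥-elim (1+n≰n (Finₚ.injective⇒≤ index-injective))
  where
  witness : ∀ c → ∃ λ i → Q c i × i₀ ≢ i
  witness c with all-hit c
  ... | i , q with i₀ Finₚ.≟ i
  ...   | no  i₀≢i = i , q , i₀≢i
  ...   | yes refl = i₁ , subst (λ c′ → Q c′ i₁) (functional c₀ c i₀ q₀ q) q₁ , i₀≢i₁

  index : Fin (suc m) → Fin m
  index c = punchOut (proj₂ (proj₂ (witness c)))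

  index-injective : ∀ {c c′} → index c ≡ index c′ → c ≡ c′
  index-injective {c} {c′} e with witness c | witness c′ | Finₚ.punchOut-injective
                                   (proj₂ (proj₂ (witness c))) (proj₂ (proj₂ (witness c′))) e
  ... | i , q , _ | .i , q′ , _ | refl = functional c c′ i q q′

module Columns (k : ℕ) where

  n : ℕ
  n = suc k

  infix 4 _≋_
  _≋_ : ℕ → ℕ → Set
  a ≋ b = a % n ≡ b % n

  +-congʳ-≋ : ∀ a b c → a ≋ b → a + c ≋ b + c
  +-congʳ-≋ a b c a≋b = begin
    (a + c) % n          ≡⟨ %-distribˡ-+ a c n ⟩
    (a % n + c % n) % n  ≡⟨ cong (λ r → (r + c % n) % n) a≋b ⟩
    (b % n + c % n) % n  ≡⟨ %-distribˡ-+ b c n ⟨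
    (b + c) % n          ∎
    where open ≡-Reasoning

  +-congˡ-≋ : ∀ c a b → a ≋ b → c + a ≋ c + b
  +-congˡ-≋ c a b a≋b =
    trans (cong (_% n) (+-comm c a)) (trans (+-congʳ-≋ a b c a≋b) (cong (_% n) (+-comm b c)))

  -- Adding c * k = c * n − c undoes adding c.
  +-cancelʳ-≋ : ∀ a b c → a + c ≋ b + c → a ≋ b
  +-cancelʳ-≋ a b c a+c≋b+c = begin
    a % n                ≡⟨ [m+kn]%n≡m%n a c n ⟨
    (a + c * n) % n      ≡⟨ cong (_% n) (absorb a) ⟨
    (a + c + c * k) % n  ≡⟨ +-congʳ-≋ (a + c) (b + c) (c * k) a+c≋b+c ⟩
    (b + c + c * k) % n  ≡⟨ cong (_% n) (absorb b) ⟩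
    (b + c * n) % n      ≡⟨ [m+kn]%n≡m%n b c n ⟩
    b % n                ∎
    where
    open ≡-Reasoning
    absorb : ∀ a → a + c + c * k ≡ a + c * n
    absorb a = trans (+-assoc a c (c * k)) (cong (a +_) (sym (*-suc c k)))

  +-cancelˡ-≋ : ∀ c a b → c + a ≋ c + b → a ≋ b
  +-cancelˡ-≋ c a b c+a≋c+b = +-cancelʳ-≋ a b c
    (trans (cong (_% n) (+-comm a c)) (trans c+a≋c+b (cong (_% n) (+-comm c b))))

  ≋⇒≡ : ∀ {a b} → a < n → b < n → a ≋ b → a ≡ b
  ≋⇒≡ a<n b<n a≋b = trans (sym (m<n⇒m%n≡m a<n)) (trans a≋b (m<n⇒m%n≡m b<n))

  toℕ-≋-injective : ∀ {i j : Fin n} → toℕ i ≋ toℕ j → i ≡ j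
  toℕ-≋-injective = Finₚ.toℕ-injective ∘′ ≋⇒≡ (Finₚ.toℕ<n _) (Finₚ.toℕ<n _)

  shift : ℕ → Fin n → Fin n
  shift A i = fromℕ< (m%n<n (toℕ i + A) n)

  toℕ-shift : ∀ A i → toℕ (shift A i) ≡ (toℕ i + A) % n
  toℕ-shift A i = Finₚ.toℕ-fromℕ< (m%n<n (toℕ i + A) n)

  shift-inverse : ∀ A B c → A + B ≡ c * n → ∀ i → shift B (shift A i) ≡ i
  shift-inverse A B c A+B≡cn i = Finₚ.toℕ-injective (begin
    toℕ (shift B (shift A i))  ≡⟨ toℕ-shift B (shift A i) ⟩
    (toℕ (shift A i) + B) % n  ≡⟨ +-congʳ-≋ (toℕ (shift A i)) (toℕ i + A) B
                                    (trans (cong (_% n) (toℕ-shift A i)) (m%n%n≡m%n (toℕ i + A) n)) ⟩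
    (toℕ i + A + B) % n        ≡⟨ cong (_% n) (+-assoc (toℕ i) A B) ⟩
    (toℕ i + (A + B)) % n      ≡⟨ cong (λ C → (toℕ i + C) % n) A+B≡cn ⟩
    (toℕ i + c * n) % n        ≡⟨ [m+kn]%n≡m%n (toℕ i) c n ⟩
    toℕ i % n                  ≡⟨ m<n⇒m%n≡m (Finₚ.toℕ<n i) ⟩
    toℕ i                      ∎)
    where open ≡-Reasoning

  rotation : ℕ → Permutation′ n
  rotation A = permutation (shift A) (shift (A * k))
    (shift-inverse (A * k) A A (trans (+-comm (A * k) A) (sym (*-suc A k))))
    (shift-inverse A (A * k) A (sym (*-suc A k)))

  vertex : Permutation′ k → ℕ → Permutation′ n
  vertex x A = lift₀ x ∘ₚ rotation A

  value : Permutation′ k → Fin n → ℕ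
  value x i = toℕ (lift₀ x ⟨$⟩ʳ i)

  vertex-agree : ∀ x y A B i → vertex x A ⟨$⟩ʳ i ≡ vertex y B ⟨$⟩ʳ i → value x i + A ≋ value y i + B
  vertex-agree x y A B i e =
    trans (sym (toℕ-shift A (lift₀ x ⟨$⟩ʳ i))) (trans (cong toℕ e) (toℕ-shift B (lift₀ y ⟨$⟩ʳ i)))

  vertex-injective : ∀ {x y A B} → SamePerm (vertex x A) (vertex y B) → A ≋ B × SamePerm x y
  vertex-injective {x} {y} {A} {B} s = A≋B , λ i → Finₚ.suc-injective (toℕ-≋-injective (values≋ (suc i)))
    where
    A≋B : A ≋ B
    A≋B = vertex-agree x y A B zero (s zero)

    values≋ : ∀ i → value x i ≋ value y i
    values≋ i = +-cancelʳ-≋ (value x i) (value y i) A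
      (trans (vertex-agree x y A B i (s i)) (+-congˡ-≋ (value y i) B A (sym A≋B)))

  vertex-adjacent : ∀ x {A B} → ¬ A ≋ B → Adjacent (vertex x A) (vertex x B)
  vertex-adjacent x {A} {B} A≉B i e = A≉B (+-cancelˡ-≋ (value x i) A B (vertex-agree x x A B i e))

  Gap : Permutation′ k → Permutation′ k → ℕ → Set
  Gap x y c = ∀ i → ¬ value x i ≋ value y i + c

  gap⇒adjacent : ∀ {x y c} → Gap x y c → ∀ A → Adjacent (vertex x A) (vertex y (A + c))
  gap⇒adjacent {x} {y} {c} gap A i e = gap i (+-cancelʳ-≋ (value x i) (value y i + c) A
    (trans (vertex-agree x y A (A + c) i e) (cong (_% n) (+-reorder (value y i)))))
    where
    +-reorder : ∀ a → a + (A + c) ≡ a + c + A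
    +-reorder a = trans (cong (a +_) (+-comm A c)) (sym (+-assoc a c A))

  -- The differences value x i − value y i (mod n) vanish at i = 0 and at i = p + 1,
  -- so one of the n residues is never taken.
  share⇒gap : ∀ {x y} → Share x y → ∃ (Gap x y)
  share⇒gap {x} {y} (p , xp≡yp) =
    let c , unhit = collision⇒unhit Q Q? functional {zero} {zero} {suc p} (λ ()) refl
                      (cong (_% n) (trans (cong (λ z → suc (toℕ z)) xp≡yp) (sym (+-identityʳ _))))
    in toℕ c , unhit
    where
    Q : Fin n → Fin n → Set
    Q c i = value x i ≋ value y i + toℕ c

    Q? : ∀ c i → Dec (Q c i)
    Q? c i = value x i % n ≟ (value y i + toℕ c) % n

    functional : ∀ c c′ i → Q c i → Q c′ i → c ≡ c′
    functional c c′ i q q′ = toℕ-≋-injective (+-cancelˡ-≋ (value y i) _ _ (trans (sym q) q′))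

-- Long paths through the columns

module ColumnPaths (j : ℕ) where

  k : ℕ
  k = suc (suc (suc j))

  open Columns k public

  Offsets : List ℕ → Set
  Offsets = AllPairs (λ u v → ¬ u ≋ v)

  incongruent : ∀ {u v} → u < n → v < n → u ≢ v → ¬ u ≋ v
  incongruent u<n v<n u≢v = u≢v ∘′ ≋⇒≡ u<n v<n

  columnOrder : ℕ → List ℕ
  columnOrder m = 0 ∷ applyUpTo (2 +_) m ∷ʳ 1

  columnOrder-offsets : ∀ {m} → 2 + m ≤ n → Offsets (columnOrder m)
  columnOrder-offsets {m} 2+m≤n =
    Allₚ.∷ʳ⁺ (Allₚ.applyUpTo⁺₁ _ m λ i<m → incongruent 0<n (inner i<m) (λ ()))
             (incongruent 0<n 1<n (λ ())) ∷
    AllPairsₚ.++⁺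
      (AllPairsₚ.applyUpTo⁺₁ _ m λ i<i′ i′<m →
         incongruent (inner (<-trans i<i′ i′<m)) (inner i′<m) (<⇒≢ i<i′ ∘′ suc-injective ∘′ suc-injective))
      ([] ∷ [])
      (Allₚ.applyUpTo⁺₁ _ m λ i<m → incongruent (inner i<m) 1<n (λ ()) ∷ [])
    where
    0<n : 0 < n
    0<n = s≤s z≤n
    1<n : 1 < n
    1<n = s≤s (s≤s z≤n)
    inner : ∀ {i} → i < m → 2 + i < n
    inner i<m = <-≤-trans (+-monoʳ-< 2 i<m) 2+m≤n

  columnOrder-split : ∀ m → columnOrder (suc m) ≡ (0 ∷ applyUpTo (2 +_) m) ++ (2 + m ∷ 1 ∷ [])
  columnOrder-split m = cong (0 ∷_) (trans
    (cong (_∷ʳ 1) (sym (Listₚ.applyUpTo-∷ʳ (2 +_) m)))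
    (Listₚ.++-assoc (applyUpTo (2 +_) m) (2 + m ∷ []) (1 ∷ [])))

  length-columnOrder : ∀ m → length (columnOrder m) ≡ 2 + m
  length-columnOrder m = cong suc (begin
    length (applyUpTo (2 +_) m ∷ʳ 1)  ≡⟨ Listₚ.length-++ (applyUpTo (2 +_) m) ⟩
    length (applyUpTo (2 +_) m) + 1   ≡⟨ cong (_+ 1) (Listₚ.length-applyUpTo (2 +_) m) ⟩
    m + 1                             ≡⟨ +-comm m 1 ⟩
    1 + m                             ∎)
    where open ≡-Reasoning

  column : Permutation′ k → ℕ → List ℕ → List (Permutation′ n)
  column x B = map (λ o → vertex x (o + B))

  column-path : ∀ x B {o os} → Offsets (o ∷ os) →
                Path Adjacent (vertex x (o + B)) (vertex x (lastOf o os + B)) (column x B (o ∷ os))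
  column-path x B offsets = Path-map (λ o → vertex x (o + B)) (λ adj → adj)
    (clique⇒Path {R = λ u v → Adjacent (vertex x (u + B)) (vertex x (v + B))}
                 (λ {u} {v} u≉v → vertex-adjacent x (u≉v ∘′ +-cancelʳ-≋ u v B)) offsets)

  column-unique : ∀ x B {os} → Offsets os → AllPairs _≉_ (column x B os)
  column-unique x B offsets = AllPairsₚ.map⁺
    (AllPairs.map (λ {u} {v} u≉v s → u≉v (+-cancelʳ-≋ u v B (proj₁ (vertex-injective s)))) offsets)

  column-all : ∀ {P : Permutation′ n → Set} x B → (∀ A → P (vertex x A)) → ∀ os → All P (column x B os)
  column-all x B p os = Allₚ.map⁺ (All.universal (λ o → p (o + B)) os)

  InColumns : List (Permutation′ k) → Permutation′ n → Set
  InColumns ys w = Any (λ y → ∃ λ B → SamePerm w (vertex y B)) ys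

  inOwnColumn : ∀ {x ys} A → InColumns (x ∷ ys) (vertex x A)
  inOwnColumn A = here (A , λ _ → refl)

  vertex-apart : ∀ x A {ys} w → All (x ≉_) ys → InColumns ys w → vertex x A ≉ w
  vertex-apart x A w (x≉y ∷ _)    (here (B , w≈)) s =
    x≉y (proj₂ (vertex-injective (λ i → trans (s i) (w≈ i))))
  vertex-apart x A w (_   ∷ x≉ys) (there w∈)     s = vertex-apart x A w x≉ys w∈ s

  ColumnPath : Permutation′ k → List (Permutation′ k) → ℕ → ℕ → Set
  ColumnPath x ys B L = Σ (List (Permutation′ n)) λ ws →
    Path Adjacent (vertex x B) (vertex x (suc B)) ws × length ws ≡ L ×
    AllPairs _≉_ ws × All (InColumns (x ∷ ys)) ws

  columnPath-single : ∀ x ys B {m} → 2 + m ≤ n → ColumnPath x ys B (2 + m)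
  columnPath-single x ys B {m} 2+m≤n =
    column x B (columnOrder m) ,
    subst (λ o → Path Adjacent (vertex x B) (vertex x (o + B)) (column x B (columnOrder m)))
          (lastOf-∷ʳ 0 (applyUpTo (2 +_) m) 1) (column-path x B offsets) ,
    trans (Listₚ.length-map _ (columnOrder m)) (length-columnOrder m) ,
    column-unique x B offsets ,
    column-all x B inOwnColumn (columnOrder m)
    where
    offsets = columnOrder-offsets 2+m≤n

  -- Leave the column of x at offset e, follow the path through the columns of y ∷ ys,
  -- and come back at offset e + 1.
  columnPath-excursion : ∀ {x y ys c B L} → Gap x y c → All (x ≉_) (y ∷ ys) →
                         ∀ P Q {e} → lastOf 0 P ≡ e → lastOf (suc e) Q ≡ 1 →
                         Offsets ((0 ∷ P) ++ (suc e ∷ Q)) → ColumnPath y ys (e + B + c) L →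
                         ColumnPath x (y ∷ ys) B (length ((0 ∷ P) ++ (suc e ∷ Q)) + L)
  columnPath-excursion {x} {B = B} gap x≉ P Q {e} P-last Q-last offsets
                       (ws , ws-path , ws-length , ws-unique , ws-in) =
    before ++ ws ++ after , path , len , unique , located
    where
    before = column x B (0 ∷ P)
    after  = column x B (suc e ∷ Q)

    column≡before++after : column x B ((0 ∷ P) ++ (suc e ∷ Q)) ≡ before ++ after
    column≡before++after = Listₚ.map-++ _ (0 ∷ P) (suc e ∷ Q)

    split = AllPairs-++⁻ (0 ∷ P) offsets

    path : Path Adjacent (vertex x B) (vertex x (suc B)) (before ++ ws ++ after)
    path = subst (λ o → Path Adjacent (vertex x B) (vertex x (o + B)) before) P-last
                 (column-path x B (proj₁ split))
           ++⟨ gap⇒adjacent gap (e + B) ⟩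
           ws-path
           ++⟨ (λ i eq → gap⇒adjacent gap (suc e + B) i (sym eq)) ⟩
           subst (λ o → Path Adjacent (vertex x (suc e + B)) (vertex x (o + B)) after) Q-last
                 (column-path x B (proj₂ split))

    len : length (before ++ ws ++ after) ≡ length ((0 ∷ P) ++ (suc e ∷ Q)) + _
    len = trans (length-middle before ws after)
                (cong₂ _+_ (trans (cong length (sym column≡before++after))
                                  (Listₚ.length-map _ ((0 ∷ P) ++ (suc e ∷ Q))))
                           ws-length)

    unique : AllPairs _≉_ (before ++ ws ++ after)
    unique = AllPairs-middle⁺ before
      (subst (AllPairs _≉_) column≡before++after (column-unique x B offsets)) ws-unique
      (column-all x B (λ A → All.map (λ {w} → vertex-apart x A w x≉) ws-in) (0 ∷ P))
      (All.map (λ {w} w∈ → column-all x B (λ A s → vertex-apart x A w x≉ w∈ (λ i → sym (s i)))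
                                      (suc e ∷ Q))
               ws-in)

    located : All (InColumns (x ∷ _)) (before ++ ws ++ after)
    located = Allₚ.++⁺ (column-all x B inOwnColumn (0 ∷ P))
                       (Allₚ.++⁺ (All.map there ws-in) (column-all x B inOwnColumn (suc e ∷ Q)))

  Gapped : Permutation′ k → Permutation′ k → Set
  Gapped x y = ∃ (Gap x y)

  -- A column contributes 2 or n vertices around an excursion, and the excursion needs at
  -- least 2; hence L = n + 1 is the one case where the first column contributes only 2.
  columnPath : ∀ {x ys} B {L} → Linked Gapped (x ∷ ys) → AllPairs _≉_ (x ∷ ys) →
               2 ≤ L → L ≤ n * length (x ∷ ys) → ColumnPath x ys B L
  columnPath B {L} _ _ 2≤L _ with L ≤? n
  ... | yes L≤n = subst (ColumnPath _ _ B) (m+[n∸m]≡n 2≤L)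
                        (columnPath-single _ _ B (subst (_≤ n) (sym (m+[n∸m]≡n 2≤L)) L≤n))
  columnPath {ys = []} B {L} _ _ _ L≤n*1 | no L≰n = ⊥-elim (L≰n (subst (L ≤_) (*-identityʳ n) L≤n*1))
  columnPath {x} {y ∷ ys} B {L} ((c , gap) ∷ gapped) (x≉ ∷ unique) 2≤L L≤ | no L≰n
    with L ≟ suc n
  ... | yes refl =
    columnPath-excursion gap x≉ [] [] refl refl (columnOrder-offsets (s≤s (s≤s z≤n)))
      (columnPath _ gapped unique (s≤s (s≤s z≤n)) (≤-trans (n≤1+n _) (m≤m*n n (length (y ∷ ys)))))
  ... | no L≢1+n =
    subst (ColumnPath x (y ∷ ys) B) total
      (columnPath-excursion gap x≉ P (1 ∷ []) P-last refl offsets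
        (columnPath _ gapped unique 2≤L∸n L∸n≤))
    where
    P : List ℕ
    P = applyUpTo (2 +_) (suc j)

    P-last : lastOf 0 P ≡ 2 + j
    P-last = trans (cong (lastOf 0) (sym (Listₚ.applyUpTo-∷ʳ (2 +_) j)))
                   (lastOf-∷ʳ 0 (applyUpTo (2 +_) j) (2 + j))

    offsets : Offsets ((0 ∷ P) ++ (3 + j ∷ 1 ∷ []))
    offsets = subst Offsets (columnOrder-split (suc j)) (columnOrder-offsets ≤-refl)

    n<L : n < L
    n<L = ≰⇒> L≰n

    total : length ((0 ∷ P) ++ (3 + j ∷ 1 ∷ [])) + (L ∸ n) ≡ L
    total = trans (cong (_+ (L ∸ n)) (trans (cong length (sym (columnOrder-split (suc j))))
                                            (length-columnOrder (2 + j))))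
                  (m+[n∸m]≡n (<⇒≤ n<L))

    2≤L∸n : 2 ≤ L ∸ n
    2≤L∸n = subst (_≤ L ∸ n) (m+n∸n≡m 2 n) (∸-monoˡ-≤ n (≤∧≢⇒< n<L (L≢1+n ∘′ sym)))

    L∸n≤ : L ∸ n ≤ n * length (y ∷ ys)
    L∸n≤ = m≤n+o⇒m∸n≤o L n (subst (L ≤_) (*-suc n (length (y ∷ ys))) L≤)

  someCycleThrough : ∀ {xs} → Linked Share xs → AllPairs _≉_ xs → length xs ≡ k ! →
                     ∀ {ℓ} → 3 ≤ ℓ → ℓ ≤ n ! → ∃ λ w → CycleThrough n w ℓ
  someCycleThrough {[]}     _      _      0≡k! _ _ = ⊥-elim (<⇒≢ (1≤n! k) 0≡k!)
  someCycleThrough {x ∷ xs} shares unique len {suc m} (s≤s 2≤m) ℓ≤n! =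
    let ws , path , ws-length , ws-unique , _ =
          columnPath 0 (Linked.map share⇒gap shares) unique (≤-trans (n≤1+n 2) (s≤s 2≤m))
                     (subst (λ l → suc m ≤ n * l) (sym len) ℓ≤n!)
    in vertex x 0 , closedPath⇒CycleThrough path (vertex-adjacent x (λ ())) ws-unique ws-length

corollary2 : (n : ℕ) → 4 ≤ n → VertexPancyclic n
corollary2 (suc (suc (suc (suc j)))) (s≤s (s≤s (s≤s (s≤s z≤n)))) v ℓ 3≤ℓ ℓ≤n! =
  let _ , cycle = ColumnPaths.someCycleThrough j (permutations-linked j) (permutations-unique (3 + j))
                                               (length-permutations (3 + j)) 3≤ℓ ℓ≤n!
  in CycleThrough-transport cycle
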